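{- Let $\Sigma$ be a finite alphabet and let $s=s_0,\ldots,s_{2r-1}\in\Sigma^{2r}$ be an even string. Then there exists a binary sequence $v_0,\ldots,v_{r-1}\in\{0,1\}$ such that the string $s_v=s_{0+v_0},s_{2+v_1},\ldots,s_{2(r-1)+v_{r-1}}$ satisfies $n_a(s_v)=n_a(s)/2$ for all $a\in\Sigma$.
   Context: For a string $s$ over $\Sigma$ and $a\in\Sigma$, $n_a(s)$ denotes the number of occurrences of $a$ in $s$. A string $s$ is even if $n_a(s)$ is even for every $a\in\Sigma$. -}

module Defs where

open import Data.Nat using (ℕ; zero; suc; _+_; _*_; _<_)
open import Data.Nat.Properties using (≤-trans; +-monoˡ-≤; *-monoʳ-≤; ≤-refl; ≤-reflexive; *-suc)
open import Data.Fin using (Fin; toℕ; fromℕ<)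
open import Data.Fin.Properties using (toℕ<n)
open import Data.Vec using (Vec; []; _∷_; lookup; tabulate; count)
open import Relation.Binary.PropositionalEquality using (_≡_; sym)
open import Relation.Binary.Definitions using (DecidableEquality)
open import Relation.Nullary using (Dec; yes; no)
open import Data.Product using (∃)

occ : ∀ {Σ : Set} → DecidableEquality Σ → ∀ {n} → Σ → Vec Σ n → ℕ
occ _≟_ a s = count (λ x → x ≟ a) s

IsEven : ∀ {Σ : Set} → DecidableEquality Σ → ∀ {n} → Vec Σ n → Set
IsEven _≟_ s = ∀ a → ∃ λ m → occ _≟_ a s ≡ 2 * m

pairIdx : ∀ {r} → Fin r → Fin 2 → Fin (2 * r)
pairIdx {r} i b = fromℕ< (lem (toℕ<n i) (toℕ<n b))
  where
  lem : ∀ {i b} → i < r → b < 2 → b + 2 * i < 2 * r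
  lem {i} {b} i<r b<2 = ≤-trans (+-monoˡ-≤ (2 * i) b<2) (≤-trans (≤-reflexive (sym (*-suc 2 i))) (*-monoʳ-≤ 2 i<r))

select : ∀ {Σ : Set} {r} → Vec Σ (2 * r) → Vec (Fin 2) r → Vec Σ r
select s v = tabulate (λ i → lookup s (pairIdx i (lookup v i)))

-- Read the pairs (s₂ᵢ , s₂ᵢ₊₁) of the string as the edges of a multigraph on the
-- alphabet; then n_a(s) is the degree of a, and a choice v picks one endpoint
-- (the "head") of every edge.  The theorem says: if every degree is even, the
-- edges can be oriented so that every vertex is the head of exactly half of its
-- edges (orient along Euler circuits).  We prove this by induction on the number
-- of edges, without constructing circuits:
--   * a loop x–x is oriented arbitrarily and removed;
--   * for an edge x–y with x ≠ y, the degree of y is even, so another edge y–z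
--     exists; the path x–y–z is replaced by the single edge x–z, and an
--     orientation of the smaller graph extends to the path by orienting both
--     edges like x–z, which makes y the head of exactly one of them.
module Submission where

open import Defs
open import Data.Nat using (ℕ; zero; suc; _+_; _*_; _∸_)
open import Data.Nat.Properties using (*-suc; +-comm; +-assoc; *-distribˡ-∸; m+n∸n≡m; even≢odd; +-commutativeSemigroup)
open import Algebra.Properties.CommutativeSemigroup +-commutativeSemigroup using (x∙yz≈y∙xz)
open import Data.Nat.Tactic.RingSolver using (solve-∀)
open import Data.Fin using (Fin; toℕ) renaming (zero to fz; suc to fs)
import Data.Fin
open import Data.Fin.Properties using (toℕ-fromℕ<; toℕ-injective)
open import Data.Vec using (Vec; []; _∷_; head; lookup; tabulate; zipWith)
open import Data.Vec.Properties using (lookup∘tabulate; lookup-zipWith; tabulate-cong; tabulate∘lookup)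
open import Data.Product using (∃; ∃₂; _×_; _,_)
open import Data.Bool using (true; false; if_then_else_)
open import Data.Empty using (⊥-elim)
open import Relation.Binary.PropositionalEquality
  using (_≡_; _≢_; refl; sym; trans; cong; cong₂; subst; module ≡-Reasoning)
open import Relation.Binary.Definitions using (DecidableEquality)
open import Relation.Nullary using (¬_; yes; no; does)
open ≡-Reasoning

Even : ℕ → Set
Even n = ∃ λ m → n ≡ 2 * m

even-cancel : ∀ n c → Even (n + 2 * c) → Even n
even-cancel n c (m , n+2c≡2m) = m ∸ c , (begin
  n                  ≡⟨ sym (m+n∸n≡m n (2 * c)) ⟩
  n + 2 * c ∸ 2 * c  ≡⟨ cong (_∸ 2 * c) n+2c≡2m ⟩
  2 * m ∸ 2 * c      ≡⟨ sym (*-distribˡ-∸ 2 m c) ⟩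
  2 * (m ∸ c)        ∎)

¬even-1 : ¬ Even 1
¬even-1 (m , 1≡2m) = even≢odd m 0 (sym 1≡2m)

lookup-subst : ∀ {A : Set} {m n} (e : m ≡ n) (s : Vec A m) {i : Fin m} {j : Fin n} →
               toℕ i ≡ toℕ j → lookup s i ≡ lookup (subst (Vec A) e s) j
lookup-subst refl s i≡j = cong (lookup s) (toℕ-injective i≡j)

toℕ-pairIdx : ∀ {r} (i : Fin r) (b : Fin 2) → toℕ (pairIdx i b) ≡ toℕ b + 2 * toℕ i
toℕ-pairIdx i b = toℕ-fromℕ< _

module EvenStrings {A : Set} (_≟_ : DecidableEquality A) where

  δ : A → A → ℕ
  δ a x = if does (x ≟ a) then 1 else 0

  occ-∷ : ∀ {n} a x (xs : Vec A n) → occ _≟_ a (x ∷ xs) ≡ δ a x + occ _≟_ a xs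
  occ-∷ a x xs with does (x ≟ a)
  ... | true  = refl
  ... | false = refl

  occ-∷∷ : ∀ {n} a x y (xs : Vec A n) → occ _≟_ a (x ∷ y ∷ xs) ≡ δ a x + δ a y + occ _≟_ a xs
  occ-∷∷ a x y xs = begin
    occ _≟_ a (x ∷ y ∷ xs)          ≡⟨ occ-∷ a x (y ∷ xs) ⟩
    δ a x + occ _≟_ a (y ∷ xs)      ≡⟨ cong (δ a x +_) (occ-∷ a y xs) ⟩
    δ a x + (δ a y + occ _≟_ a xs)  ≡⟨ sym (+-assoc (δ a x) (δ a y) (occ _≟_ a xs)) ⟩
    δ a x + δ a y + occ _≟_ a xs    ∎

  δ-self : ∀ a → δ a a ≡ 1
  δ-self a with a ≟ a
  ... | yes _   = refl
  ... | no a≢a  = ⊥-elim (a≢a refl)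

  δ-other : ∀ {a x} → x ≢ a → δ a x ≡ 0
  δ-other {a} {x} x≢a with x ≟ a
  ... | yes x≡a = ⊥-elim (x≢a x≡a)
  ... | no _    = refl

  -- An edge of a multigraph on A; a list of edges is the multigraph itself.
  Pair : Set
  Pair = A × A

  deg : ∀ {n} → A → Vec Pair n → ℕ
  deg a []            = 0
  deg a ((x , y) ∷ P) = δ a x + δ a y + deg a P

  EvenDegrees : ∀ {n} → Vec Pair n → Set
  EvenDegrees P = ∀ a → Even (deg a P)

  end : Fin 2 → Pair → A
  end fz     (x , _) = x
  end (fs _) (_ , y) = y

  heads : ∀ {n} → Vec (Fin 2) n → Vec Pair n → Vec A n
  heads = zipWith end

  Balanced : ∀ {n} → Vec Pair n → Vec (Fin 2) n → Set
  Balanced P v = ∀ a → 2 * occ _≟_ a (heads v P) ≡ deg a P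

  data Removal : ∀ {m} → Vec Pair (suc m) → Pair → Vec Pair m → Set where
    here    : ∀ {m x y} {P : Vec Pair m} → Removal ((x , y) ∷ P) (x , y) P
    flipped : ∀ {m x y} {P : Vec Pair m} → Removal ((y , x) ∷ P) (x , y) P
    there   : ∀ {m p e} {P : Vec Pair (suc m)} {P' : Vec Pair m} →
              Removal P e P' → Removal (p ∷ P) e (p ∷ P')

  find-removal : ∀ {m} y (Q : Vec Pair (suc m)) → deg y Q ≢ 0 →
                 ∃₂ λ z (Q' : Vec Pair m) → Removal Q (y , z) Q'
  find-removal y ((u , w) ∷ Q) y∈Q with u ≟ y | w ≟ y
  ... | yes refl | _        = w , Q , here
  ... | no _     | yes refl = u , Q , flipped
  find-removal {zero}  y ((u , w) ∷ []) y∈Q | no _ | no _ = ⊥-elim (y∈Q refl)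
  -- in this branch both endpoints contribute 0, so y∈Q says deg y Q ≢ 0
  find-removal {suc m} y ((u , w) ∷ Q)  y∈Q | no _ | no _ with find-removal y Q y∈Q
  ... | z , Q' , removal = z , (u , w) ∷ Q' , there removal

  removal-deg : ∀ {m} {P : Vec Pair (suc m)} {e P'} → Removal P e P' →
                ∀ a → deg a P ≡ deg a (e ∷ P')
  removal-deg here a = refl
  removal-deg (flipped {x = x} {y} {P}) a = cong (_+ deg a P) (+-comm (δ a y) (δ a x))
  removal-deg (there {p = u , w} {e = x , y} {P = P} {P' = P'} removal) a = begin
    δ a u + δ a w + deg a P
      ≡⟨ cong (δ a u + δ a w +_) (removal-deg removal a) ⟩
    δ a u + δ a w + (δ a x + δ a y + deg a P')
      ≡⟨ x∙yz≈y∙xz (δ a u + δ a w) (δ a x + δ a y) (deg a P') ⟩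
    δ a x + δ a y + (δ a u + δ a w + deg a P')
      ∎

  removal-heads : ∀ {m} {P : Vec Pair (suc m)} {e P'} → Removal P e P' →
                  (u : Vec (Fin 2) (suc m)) →
                  ∃ λ v → ∀ a → occ _≟_ a (heads v P) ≡ occ _≟_ a (heads u (e ∷ P'))
  removal-heads here    u           = u , λ _ → refl
  removal-heads flipped (fz ∷ w)    = fs fz ∷ w , λ _ → refl
  removal-heads flipped (fs fz ∷ w) = fz ∷ w , λ _ → refl
  removal-heads (there {p = p} {e = e} {P = P} {P' = P'} removal) (c ∷ b ∷ w)
    with removal-heads removal (c ∷ w)
  ... | v , same = b ∷ v , λ a → begin
    occ _≟_ a (end b p ∷ heads v P)
      ≡⟨ occ-∷ a (end b p) (heads v P) ⟩
    δ a (end b p) + occ _≟_ a (heads v P)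
      ≡⟨ cong (δ a (end b p) +_) (trans (same a) (occ-∷ a (end c e) W)) ⟩
    δ a (end b p) + (δ a (end c e) + occ _≟_ a W)
      ≡⟨ x∙yz≈y∙xz (δ a (end b p)) (δ a (end c e)) (occ _≟_ a W) ⟩
    δ a (end c e) + (δ a (end b p) + occ _≟_ a W)
      ≡⟨ cong (δ a (end c e) +_) (sym (occ-∷ a (end b p) W)) ⟩
    δ a (end c e) + occ _≟_ a (end b p ∷ W)
      ≡⟨ sym (occ-∷ a (end c e) (end b p ∷ W)) ⟩
    occ _≟_ a (end c e ∷ end b p ∷ W)
      ∎
    where
    W : Vec A _
    W = heads w P'

  removal-balanced : ∀ {m} {P : Vec Pair (suc m)} {e P'} → Removal P e P' →
                     ∀ u → Balanced (e ∷ P') u → ∃ (Balanced P)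
  removal-balanced removal u balanced with removal-heads removal u
  ... | v , same = v , λ a →
    trans (cong (2 *_) (same a)) (trans (balanced a) (sym (removal-deg removal a)))

  deg-loop : ∀ {n} x (Q : Vec Pair n) a → deg a ((x , x) ∷ Q) ≡ deg a Q + 2 * δ a x
  deg-loop x Q a = rearrange (δ a x) (deg a Q)
    where
    rearrange : ∀ i d → i + i + d ≡ d + 2 * i
    rearrange = solve-∀

  loop-even : ∀ {n} x (Q : Vec Pair n) → EvenDegrees ((x , x) ∷ Q) → EvenDegrees Q
  loop-even x Q even a = even-cancel (deg a Q) (δ a x) (subst Even (deg-loop x Q a) (even a))

  loop-balanced : ∀ {n} x (Q : Vec Pair n) w → Balanced Q w → Balanced ((x , x) ∷ Q) (fz ∷ w)
  loop-balanced x Q w balanced a = begin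
    2 * occ _≟_ a (x ∷ heads w Q)          ≡⟨ cong (2 *_) (occ-∷ a x (heads w Q)) ⟩
    2 * (δ a x + occ _≟_ a (heads w Q))    ≡⟨ rearrange (δ a x) (occ _≟_ a (heads w Q)) ⟩
    2 * occ _≟_ a (heads w Q) + 2 * δ a x  ≡⟨ cong (_+ 2 * δ a x) (balanced a) ⟩
    deg a Q + 2 * δ a x                    ≡⟨ sym (deg-loop x Q a) ⟩
    deg a ((x , x) ∷ Q)                    ∎
    where
    rearrange : ∀ i o → 2 * (i + o) ≡ 2 * o + 2 * i
    rearrange = solve-∀

  deg-shortcut : ∀ {n} x y z (Q : Vec Pair n) a →
                 deg a ((y , z) ∷ (x , y) ∷ Q) ≡ deg a ((x , z) ∷ Q) + 2 * δ a y
  deg-shortcut x y z Q a = rearrange (δ a x) (δ a y) (δ a z) (deg a Q)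
    where
    rearrange : ∀ p q r d → q + r + (p + q + d) ≡ p + r + d + 2 * q
    rearrange = solve-∀

  shortcut-even : ∀ {m x y z} {Q : Vec Pair (suc m)} {Q'} → Removal Q (y , z) Q' →
                  EvenDegrees ((x , y) ∷ Q) → EvenDegrees ((x , z) ∷ Q')
  shortcut-even {x = x} {y} {z} {Q' = Q'} removal even a =
    even-cancel (deg a ((x , z) ∷ Q')) (δ a y)
      (subst Even (trans (removal-deg (there removal) a) (deg-shortcut x y z Q' a)) (even a))

  path-heads : ∀ c x y z a → δ a (end c (y , z)) + δ a (end c (x , y)) ≡ δ a (end c (x , z)) + δ a y
  path-heads fz     x y z a = +-comm (δ a y) (δ a x)
  path-heads (fs _) x y z a = refl

  shortcut-balanced : ∀ {n} x y z (Q : Vec Pair n) (v : Vec (Fin 2) (suc n)) →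
                      Balanced ((x , z) ∷ Q) v → Balanced ((y , z) ∷ (x , y) ∷ Q) (head v ∷ v)
  shortcut-balanced x y z Q (c ∷ w) balanced a = begin
    2 * occ _≟_ a (end c (y , z) ∷ end c (x , y) ∷ O)
      ≡⟨ cong (2 *_) (occ-∷∷ a (end c (y , z)) (end c (x , y)) O) ⟩
    2 * (δ a (end c (y , z)) + δ a (end c (x , y)) + occ _≟_ a O)
      ≡⟨ cong (λ t → 2 * (t + occ _≟_ a O)) (path-heads c x y z a) ⟩
    2 * (δ a (end c (x , z)) + δ a y + occ _≟_ a O)
      ≡⟨ rearrange (δ a (end c (x , z))) (δ a y) (occ _≟_ a O) ⟩
    2 * (δ a (end c (x , z)) + occ _≟_ a O) + 2 * δ a y
      ≡⟨ cong (λ t → 2 * t + 2 * δ a y) (sym (occ-∷ a (end c (x , z)) O)) ⟩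
    2 * occ _≟_ a (end c (x , z) ∷ O) + 2 * δ a y
      ≡⟨ cong (_+ 2 * δ a y) (balanced a) ⟩
    deg a ((x , z) ∷ Q) + 2 * δ a y
      ≡⟨ sym (deg-shortcut x y z Q a) ⟩
    deg a ((y , z) ∷ (x , y) ∷ Q)
      ∎
    where
    O : Vec A _
    O = heads w Q
    rearrange : ∀ i j o → 2 * (i + j + o) ≡ 2 * (i + o) + 2 * j
    rearrange = solve-∀

  continues : ∀ {n x y} (Q : Vec Pair n) → x ≢ y → EvenDegrees ((x , y) ∷ Q) → deg y Q ≢ 0
  continues {x = x} {y} Q x≢y even deg≡0 = ¬even-1 (subst Even deg-y≡1 (even y))
    where
    deg-y≡1 : deg y ((x , y) ∷ Q) ≡ 1
    deg-y≡1 = begin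
      δ y x + δ y y + deg y Q  ≡⟨ cong₂ (λ p q → p + q + deg y Q) (δ-other x≢y) (δ-self y) ⟩
      1 + deg y Q              ≡⟨ cong suc deg≡0 ⟩
      1                        ∎

  AllBalanceable : ℕ → Set
  AllBalanceable n = (P : Vec Pair n) → EvenDegrees P → ∃ (Balanced P)

  reduce : ∀ {n} → AllBalanceable n → AllBalanceable (suc n)
  reduce {n} balance ((x , y) ∷ Q) even with x ≟ y
  ... | yes refl with balance Q (loop-even x Q even)
  ...   | w , balanced = fz ∷ w , loop-balanced x Q w balanced
  reduce {zero}  balance ((x , y) ∷ []) even | no x≢y = ⊥-elim (continues [] x≢y even refl)
  reduce {suc m} balance ((x , y) ∷ Q) even | no x≢y
    with find-removal y Q (continues Q x≢y even)
  ... | z , Q' , removal with balance ((x , z) ∷ Q') (shortcut-even removal even)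
  ...   | v , balanced =
    removal-balanced (there removal) (head v ∷ v) (shortcut-balanced x y z Q' v balanced)

  balanced-orientation : ∀ n → AllBalanceable n
  balanced-orientation zero    []  _ = [] , λ _ → refl
  balanced-orientation (suc n)       = reduce (balanced-orientation n)

  pairs : ∀ r → Vec A (2 * r) → Vec Pair r
  pairs r s = tabulate λ i → lookup s (pairIdx i fz) , lookup s (pairIdx i (fs fz))

  select-pairs : ∀ r (s : Vec A (2 * r)) v → select s v ≡ heads v (pairs r s)
  select-pairs r s v = begin
    select s v                               ≡⟨ tabulate-cong selected ⟩
    tabulate (lookup (heads v (pairs r s)))  ≡⟨ tabulate∘lookup (heads v (pairs r s)) ⟩
    heads v (pairs r s)                      ∎
    where
    pair : ∀ i → Pair
    pair i = lookup s (pairIdx i fz) , lookup s (pairIdx i (fs fz))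
    end-pair : ∀ i b → lookup s (pairIdx i b) ≡ end b (pair i)
    end-pair i fz      = refl
    end-pair i (fs fz) = refl
    selected : ∀ i → lookup s (pairIdx i (lookup v i)) ≡ lookup (heads v (pairs r s)) i
    selected i = begin
      lookup s (pairIdx i (lookup v i))        ≡⟨ end-pair i (lookup v i) ⟩
      end (lookup v i) (pair i)                ≡⟨ cong (end (lookup v i)) (sym (lookup∘tabulate pair i)) ⟩
      end (lookup v i) (lookup (pairs r s) i)  ≡⟨ sym (lookup-zipWith end i v (pairs r s)) ⟩
      lookup (heads v (pairs r s)) i           ∎

  pairs-∷ : ∀ r (s : Vec A (2 * suc r)) {x y} {t : Vec A (2 * r)} →
            subst (Vec A) (*-suc 2 r) s ≡ x ∷ y ∷ t → pairs (suc r) s ≡ (x , y) ∷ pairs r t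
  pairs-∷ r s {x} {y} {t} unfolds = cong₂ _∷_
    (cong₂ _,_ (entry {j = fz} (toℕ-pairIdx {suc r} fz fz)) (entry {j = fs fz} (toℕ-pairIdx {suc r} fz (fs fz))))
    (tabulate-cong λ i → cong₂ _,_ (later i fz) (later i (fs fz)))
    where
    entry : ∀ {i j} → toℕ i ≡ toℕ j → lookup s i ≡ lookup (x ∷ y ∷ t) j
    entry {j = j} i≡j = trans (lookup-subst (*-suc 2 r) s i≡j) (cong (λ u → lookup u j) unfolds)
    shift : ∀ b i → b + 2 * suc i ≡ 2 + (b + 2 * i)
    shift = solve-∀
    later : ∀ i b → lookup s (pairIdx (fs i) b) ≡ lookup t (pairIdx i b)
    later i b = entry {j = fs (fs (pairIdx i b))} (begin
      toℕ (pairIdx (fs i) b)       ≡⟨ toℕ-pairIdx (fs i) b ⟩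
      toℕ b + 2 * suc (toℕ i)      ≡⟨ shift (toℕ b) (toℕ i) ⟩
      2 + (toℕ b + 2 * toℕ i)      ≡⟨ cong (2 +_) (sym (toℕ-pairIdx i b)) ⟩
      2 + toℕ (pairIdx i b)        ∎)

  occ-subst : ∀ {m n} a (e : m ≡ n) (s : Vec A m) → occ _≟_ a (subst (Vec A) e s) ≡ occ _≟_ a s
  occ-subst a refl s = refl

  occ-pairs : ∀ r (s : Vec A (2 * r)) a → occ _≟_ a s ≡ deg a (pairs r s)
  occ-pairs zero    []  a = refl
  occ-pairs (suc r) s   a with subst (Vec A) (*-suc 2 r) s in unfolds
  ... | x ∷ y ∷ t = begin
    occ _≟_ a s                              ≡⟨ sym (occ-subst a (*-suc 2 r) s) ⟩
    occ _≟_ a (subst (Vec A) (*-suc 2 r) s)  ≡⟨ cong (occ _≟_ a) unfolds ⟩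
    occ _≟_ a (x ∷ y ∷ t)                    ≡⟨ occ-∷∷ a x y t ⟩
    δ a x + δ a y + occ _≟_ a t              ≡⟨ cong (δ a x + δ a y +_) (occ-pairs r t a) ⟩
    deg a ((x , y) ∷ pairs r t)              ≡⟨ cong (deg a) (sym (pairs-∷ r s unfolds)) ⟩
    deg a (pairs (suc r) s)                  ∎

  even-string-halving : ∀ r (s : Vec A (2 * r)) → IsEven _≟_ s →
                        ∃ λ (v : Vec (Fin 2) r) → ∀ a → 2 * occ _≟_ a (select s v) ≡ occ _≟_ a s
  even-string-halving r s even
    with balanced-orientation r (pairs r s) (λ a → subst Even (occ-pairs r s a) (even a))
  ... | v , balanced = v , λ a → begin
    2 * occ _≟_ a (select s v)           ≡⟨ cong (λ u → 2 * occ _≟_ a u) (select-pairs r s v) ⟩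
    2 * occ _≟_ a (heads v (pairs r s))  ≡⟨ balanced a ⟩
    deg a (pairs r s)                    ≡⟨ sym (occ-pairs r s a) ⟩
    occ _≟_ a s                          ∎

lemma2 : (k r : ℕ) (s : Vec (Fin k) (2 * r)) →
         IsEven Data.Fin._≟_ s →
         ∃ λ (v : Vec (Fin 2) r) →
           ∀ (a : Fin k) → 2 * occ Data.Fin._≟_ a (select s v) ≡ occ Data.Fin._≟_ a s
lemma2 k = EvenStrings.even-string-halving (Data.Fin._≟_ {k})
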